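{- Let $S,T\subseteq[r]$ with $S$ dominating $T$, and let $u,v$ be (possibly empty) words in the noncommuting letters $\mathbf a,\mathbf b$. Then (1) $m(S)\cdot\mathbf a\cdot v$ dominates $m(T)\cdot\mathbf a\cdot v$; (2) $u\cdot\mathbf a\cdot m(S)$ dominates $u\cdot\mathbf a\cdot m(T)$; (3) $u\cdot\mathbf a\cdot m(S)\cdot\mathbf a\cdot v$ dominates $u\cdot\mathbf a\cdot m(T)\cdot\mathbf a\cdot v$.
   Context: For a word $w=w_1\cdots w_N$ in $\{\mathbf a,\mathbf b\}$, its descent set is $\{i\in[N]:w_i=\mathbf b\}$; conversely for $S\subseteq[N]$, $m(S)$ is the word $u_1\cdots u_N$ with $u_i=\mathbf b$ if $i\in S$ and $u_i=\mathbf a$ otherwise (so $\cdot$ denotes concatenation, and words are identified with their descent sets). For $\pi=a_1\cdots a_{N+1}\in S_{N+1}$ the descent set is $\{i\in[N]:a_i>a_{i+1}\}$ and $D(S)$ is the set of permutations in $S_{N+1}$ with descent set $S$. The inversion set is $I(\pi)=\{(a_i,a_j):i<j,\ a_i>a_j\}$ and the weak Bruhat order is $\pi\le_w\pi'$ iff $I(\pi)\subseteq I(\pi')$. For $S,T\subseteq[N]$ (or words of length $N$), $S$ dominates $T$ if there is an injection $\phi:D(T)\to D(S)$ with $\pi\le_w\phi(\pi)$ for all $\pi\in D(T)$. -}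

module Defs where

open import Data.Nat using (ℕ; zero; suc; _+_)
open import Data.Fin using (Fin; zero; suc; toℕ; _<_; _>_; inject₁)
open import Data.Vec using (Vec; []; _∷_; _++_; tabulate)
open import Data.Product using (Σ; _×_; _,_; proj₁; ∃)
open import Relation.Binary.PropositionalEquality using (_≡_)
open import Relation.Nullary using (Dec; yes; no)
open import Data.Fin.Properties using (_<?_)

data Letter : Set where
  𝐚 𝐛 : Letter

Word : ℕ → Set
Word N = Vec Letter N

Perm : ℕ → Set
Perm n = Σ (Fin n → Fin n) (λ f → ∀ i j → f i ≡ f j → i ≡ j)

descentWord : {N : ℕ} → Perm (suc N) → Word N
descentWord {N} (f , _) = tabulate λ (i : Fin N) →
  letter (f (inject₁ i)) (f (suc i))
  where
  letter : Fin (suc N) → Fin (suc N) → Letter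
  letter x y with y <? x
  ... | yes _ = 𝐛
  ... | no _  = 𝐚

D : {N : ℕ} → Word N → Set
D {N} w = Σ (Perm (suc N)) (λ π → descentWord π ≡ w)

_∈Inv_ : {n : ℕ} → Fin n × Fin n → Perm n → Set
_∈Inv_ (x , y) (f , _) = Σ _ λ i → Σ _ λ j → (i < j) × (f i ≡ x) × (f j ≡ y) × (y < x)

_≤w_ : {n : ℕ} → Perm n → Perm n → Set
π ≤w π' = ∀ x y → (x , y) ∈Inv π → (x , y) ∈Inv π'

_≈P_ : {n : ℕ} → Perm n → Perm n → Set
(f , _) ≈P (g , _) = ∀ i → f i ≡ g i

Dominates : {N : ℕ} → Word N → Word N → Set
Dominates {N} S T =
  Σ (D T → D S) λ φ →
    (∀ π σ → proj₁ (φ π) ≈P proj₁ (φ σ) → proj₁ π ≈P proj₁ σ)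
    × (∀ π → proj₁ π ≤w proj₁ (φ π))

module Submission where

-- Let W = x·T·y, where the letters of W just before and just after the factor T (when present)
-- are 𝐚. For π ∈ D(W), the r + 1 entries of π spanning T form a window whose standardisation α
-- lies in D(T). Rearranging the same values inside the window in the pattern φ(α) ∈ D(S)
-- yields a permutation with descent word W' = x·S·y: descents away from the window are
-- untouched, those inside are the descents of φ(α), and the two bordering ascents survive since
-- α ≤w φ(α) can only raise the first and lower the last entry of the window. Every inversion of π
-- survives too: inversions inside the window are those of α ⊆ those of φ(α), and an inversion
-- with an entry outside only depends on the set of window values. The rearranged permutation
-- determines the outside entries, the window values and φ(α), hence α, hence π. The three
-- statements are the cases x = [], y = 𝐚·v and x = u·𝐚, y = [] and a composition of the two.

open import Defs
open import Data.Bool.Properties using (T-≡)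
open import Data.Nat as ℕ using (ℕ; zero; suc; _+_; _∸_; z≤n; s≤s)
import Data.Nat.Properties as ℕ
open import Data.Fin as Fin using (Fin; zero; suc; toℕ; fromℕ<; inject₁; punchOut; opposite)
open import Data.Fin.Properties
  using ( toℕ-injective; toℕ-fromℕ; toℕ-fromℕ<; toℕ-inject₁; toℕ<n; ≤fromℕ
        ; punchOut-injective; injective⇒≤; any?; opposite-prop; opposite-involutive )
  renaming (_≟_ to _≟ᶠ_; <-cmp to <-cmpᶠ; <⇒≢ to <⇒≢ᶠ)
open import Data.Fin.Subset using (Subset; ∣_∣; _∈_; ⊤)
open import Data.Fin.Subset.Properties using (∈⊤; ∣⊤∣≡n; p⊂q⇒∣p∣<∣q∣)
open import Data.Vec using ([]; _∷_; _++_; lookup; tabulate)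
open import Data.Vec.Properties
  using (lookup∘tabulate; tabulate-cong; tabulate∘lookup; []=⇒lookup; lookup⇒[]=)
open import Data.Product using (∃; _×_; _,_; proj₁; proj₂)
open import Data.Sum using (_⊎_; inj₁; inj₂)
open import Relation.Nullary using (¬_; yes; no; contradiction)
open import Relation.Nullary.Decidable using (⌊_⌋; toWitness; fromWitness)
open import Relation.Binary using (tri<; tri≈; tri>)
open import Relation.Binary.PropositionalEquality
open import Function using (_∘_; Equivalence)

Perm-surjective : ∀ {m} (π : Perm m) (k : Fin m) → ∃ λ j → proj₁ π j ≡ k
Perm-surjective {suc m} (f , f-inj) k with any? (λ j → f j ≟ᶠ k)
... | yes hit = hit
... | no miss = contradiction (injective⇒≤ punched-injective) ℕ.1+n≰n
  where
  f≢k : ∀ j → k ≢ f j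
  f≢k j k≡fj = miss (j , sym k≡fj)

  punched : Fin (suc m) → Fin m
  punched j = punchOut (f≢k j)

  punched-injective : ∀ {i j} → punched i ≡ punched j → i ≡ j
  punched-injective {i} {j} e = f-inj i j (punchOut-injective (f≢k i) (f≢k j) e)

module Standardisation {m : ℕ} (g : Fin m → ℕ) (g-injective : ∀ i j → g i ≡ g j → i ≡ j) where

  below : Fin m → Subset m
  below j = tabulate (λ k → ⌊ g k ℕ.<? g j ⌋)

  ∈below⇒ : ∀ {j k} → k ∈ below j → g k ℕ.< g j
  ∈below⇒ {j} {k} k∈ =
    toWitness {a? = g k ℕ.<? g j} (Equivalence.from T-≡ (trans (sym (lookup∘tabulate _ k)) ([]=⇒lookup k∈)))

  ∈below⇐ : ∀ {j k} → g k ℕ.< g j → k ∈ below j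
  ∈below⇐ {j} {k} lt = lookup⇒[]= k _ (trans (lookup∘tabulate _ k) (Equivalence.to T-≡ (fromWitness lt)))

  ∉below-self : ∀ j → ¬ j ∈ below j
  ∉below-self j j∈ = ℕ.<-irrefl refl (∈below⇒ j∈)

  rank : Fin m → ℕ
  rank j = ∣ below j ∣

  rank<m : ∀ j → rank j ℕ.< m
  rank<m j = subst (rank j ℕ.<_) (∣⊤∣≡n m) (p⊂q⇒∣p∣<∣q∣ ((λ _ → ∈⊤) , j , ∈⊤ , ∉below-self j))

  rank-mono-< : ∀ {j k} → g j ℕ.< g k → rank j ℕ.< rank k
  rank-mono-< {j} lt =
    p⊂q⇒∣p∣<∣q∣ ((λ x∈ → ∈below⇐ (ℕ.<-trans (∈below⇒ x∈) lt)) , j , ∈below⇐ lt , ∉below-self j)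

  rank-cancel-< : ∀ {j k} → rank j ℕ.< rank k → g j ℕ.< g k
  rank-cancel-< {j} {k} lt with ℕ.<-cmp (g j) (g k)
  ... | tri< gj<gk _ _ = gj<gk
  ... | tri≈ _ gj≡gk _ = contradiction (cong rank (g-injective j k gj≡gk)) (ℕ.<⇒≢ lt)
  ... | tri> _ _ gk<gj = contradiction (rank-mono-< gk<gj) (ℕ.<-asym lt)

  rank-injective : ∀ {j k} → rank j ≡ rank k → j ≡ k
  rank-injective {j} {k} e with ℕ.<-cmp (g j) (g k)
  ... | tri< gj<gk _ _ = contradiction e (ℕ.<⇒≢ (rank-mono-< gj<gk))
  ... | tri≈ _ gj≡gk _ = g-injective j k gj≡gk
  ... | tri> _ _ gk<gj = contradiction (sym e) (ℕ.<⇒≢ (rank-mono-< gk<gj))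

  standardise : Perm m
  standardise = (λ j → fromℕ< (rank<m j)) , λ i j e → rank-injective (fromℕ<-rank-injective e)
    where
    fromℕ<-rank-injective : ∀ {i j} → fromℕ< (rank<m i) ≡ fromℕ< (rank<m j) → rank i ≡ rank j
    fromℕ<-rank-injective {i} {j} e =
      trans (sym (toℕ-fromℕ< (rank<m i))) (trans (cong toℕ e) (toℕ-fromℕ< (rank<m j)))

  standardise-mono-< : ∀ {j k} → g j ℕ.< g k → proj₁ standardise j Fin.< proj₁ standardise k
  standardise-mono-< {j} {k} lt =
    subst₂ ℕ._<_ (sym (toℕ-fromℕ< (rank<m j))) (sym (toℕ-fromℕ< (rank<m k))) (rank-mono-< lt)

  standardise-cancel-< : ∀ {j k} → proj₁ standardise j Fin.< proj₁ standardise k → g j ℕ.< g k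
  standardise-cancel-< {j} {k} lt =
    rank-cancel-< (subst₂ ℕ._<_ (toℕ-fromℕ< (rank<m j)) (toℕ-fromℕ< (rank<m k)) lt)

StrictlyIncreasing : ∀ {m n} → (Fin m → Fin n) → Set
StrictlyIncreasing t = ∀ {i j} → i Fin.< j → t i Fin.< t j

increasing-cancel-< : ∀ {m n} {t : Fin m → Fin n} → StrictlyIncreasing t →
  ∀ {i j} → t i Fin.< t j → i Fin.< j
increasing-cancel-< t-< {i} {j} ti<tj with <-cmpᶠ i j
... | tri< i<j _ _  = i<j
... | tri≈ _ refl _ = contradiction ti<tj (ℕ.<-irrefl refl)
... | tri> _ _ j<i  = contradiction ti<tj (ℕ.<-asym (t-< j<i))

increasing-mono-≤ : ∀ {m n} {t : Fin m → Fin n} → StrictlyIncreasing t →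
  ∀ {i j} → i Fin.≤ j → t i Fin.≤ t j
increasing-mono-≤ t-< i≤j = ℕ.≮⇒≥ (λ tj<ti → ℕ.<⇒≱ (increasing-cancel-< t-< tj<ti) i≤j)

increasing-injective : ∀ {m n} {t : Fin m → Fin n} → StrictlyIncreasing t →
  ∀ {i j} → t i ≡ t j → i ≡ j
increasing-injective t-< {i} {j} ti≡tj with <-cmpᶠ i j
... | tri< i<j _ _ = contradiction ti≡tj (<⇒≢ᶠ (t-< i<j))
... | tri≈ _ i≡j _ = i≡j
... | tri> _ _ j<i = contradiction (sym ti≡tj) (<⇒≢ᶠ (t-< j<i))

opposite-reverses-< : ∀ {m} {i j : Fin m} → i Fin.< j → opposite j Fin.< opposite i
opposite-reverses-< {i = i} {j} i<j =
  subst₂ ℕ._<_ (sym (opposite-prop j)) (sym (opposite-prop i)) (ℕ.∸-monoʳ-< (s≤s i<j) (toℕ<n j))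

increasing⇒≥id : ∀ {m} (t : Fin m → Fin m) → StrictlyIncreasing t → ∀ i → i Fin.≤ t i
increasing⇒≥id {m} t t-< i = go (toℕ i) i refl
  where
  go : ∀ k (i : Fin m) → toℕ i ≡ k → k ℕ.≤ toℕ (t i)
  go zero    i _   = z≤n
  go (suc k) i i≡k = ℕ.≤-<-trans (go k i⁻ (toℕ-fromℕ< k<m)) (t-< i⁻<i)
    where
    k<m : k ℕ.< m
    k<m = ℕ.<-trans (ℕ.n<1+n k) (subst (ℕ._< m) i≡k (toℕ<n i))
    i⁻ : Fin m
    i⁻ = fromℕ< k<m
    i⁻<i : i⁻ Fin.< i
    i⁻<i = subst₂ ℕ._<_ (sym (toℕ-fromℕ< k<m)) (sym i≡k) (ℕ.n<1+n k)

-- Conjugating by the order reversal turns the lower bound into an upper bound.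
increasing⇒≗id : ∀ {m} (t : Fin m → Fin m) → StrictlyIncreasing t → ∀ i → t i ≡ i
increasing⇒≗id {m} t t-< i = toℕ-injective (ℕ.≤-antisym (ℕ.≮⇒≥ i≮ti) (increasing⇒≥id t t-< i))
  where
  t̃ : Fin m → Fin m
  t̃ k = opposite (t (opposite k))
  t̃-< : StrictlyIncreasing t̃
  t̃-< k<l = opposite-reverses-< (t-< (opposite-reverses-< k<l))
  i≮ti : ¬ i Fin.< t i
  i≮ti i<ti = ℕ.<⇒≱ (opposite-reverses-< i<ti)
    (subst (λ k → opposite i Fin.≤ opposite (t k)) (opposite-involutive i) (increasing⇒≥id t̃ t̃-< (opposite i)))

≤w-head : ∀ {r} (σ σ' : Perm (suc r)) → σ ≤w σ' → proj₁ σ zero Fin.≤ proj₁ σ' zero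
≤w-head σ@(s , _) (s' , s'-inj) σ≤σ' = ℕ.≮⇒≥ s'₀≮s₀
  where
  s'₀≮s₀ : ¬ s' zero Fin.< s zero
  s'₀≮s₀ lt with Perm-surjective σ (s' zero)
  ... | zero  , s₀≡s'₀ = ℕ.<⇒≢ lt (cong toℕ (sym s₀≡s'₀))
  ... | suc j , sj≡s'₀ with σ≤σ' _ _ (zero , suc j , s≤s z≤n , refl , sj≡s'₀ , lt)
  ... | i , j' , i<j' , _ , s'j'≡s'₀ , _ with s'-inj j' zero s'j'≡s'₀
  ... | refl = ℕ.n≮0 i<j'

≤w-last : ∀ {r} (σ σ' : Perm (suc r)) → σ ≤w σ' → proj₁ σ' (Fin.fromℕ r) Fin.≤ proj₁ σ (Fin.fromℕ r)
≤w-last {r} σ@(s , _) (s' , s'-inj) σ≤σ' = ℕ.≮⇒≥ sₗ≮s'ₗ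
  where
  ℓ : Fin (suc r)
  ℓ = Fin.fromℕ r
  sₗ≮s'ₗ : ¬ s ℓ Fin.< s' ℓ
  sₗ≮s'ₗ lt with Perm-surjective σ (s' ℓ)
  ... | j , sj≡s'ₗ with ℕ.m≤n⇒m<n∨m≡n (≤fromℕ j)
  ... | inj₂ j≡ℓ = ℕ.<⇒≢ lt (cong toℕ (trans (cong s (sym (toℕ-injective j≡ℓ))) sj≡s'ₗ))
  ... | inj₁ j<ℓ with σ≤σ' _ _ (j , ℓ , j<ℓ , sj≡s'ₗ , refl , lt)
  ... | i , j' , i<j' , s'i≡s'ₗ , _ , _ with s'-inj i ℓ s'i≡s'ₗ
  ... | refl = ℕ.<⇒≱ i<j' (≤fromℕ j')

descent : ∀ {n} → Fin n → Fin n → Letter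
descent x y with y Fin.<? x
... | yes _ = 𝐛
... | no  _ = 𝐚

descent≡𝐚 : ∀ {n} {x y : Fin n} → ¬ y Fin.< x → descent x y ≡ 𝐚
descent≡𝐚 {x = x} {y} y≮x with y Fin.<? x
... | yes y<x = contradiction y<x y≮x
... | no  _   = refl

descent≡𝐚⁻¹ : ∀ {n} {x y : Fin n} → descent x y ≡ 𝐚 → ¬ y Fin.< x
descent≡𝐚⁻¹ {x = x} {y} d≡𝐚 with y Fin.<? x
... | no y≮x = y≮x

descent-cong : ∀ {n n'} {x y : Fin n} {x' y' : Fin n'} →
  (y Fin.< x → y' Fin.< x') → (y' Fin.< x' → y Fin.< x) → descent x y ≡ descent x' y'
descent-cong {x = x} {y} {x'} {y'} to from with y Fin.<? x | y' Fin.<? x'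
... | yes _   | yes _     = refl
... | no  _   | no  _     = refl
... | yes y<x | no  y'≮x' = contradiction (to y<x) y'≮x'
... | no  y≮x | yes y'<x' = contradiction (from y'<x') y≮x

-- The comparison used by descentWord is local to Defs; this unfolding names it by unification.
private
  lookup-descentWord-unfolded : ∀ {N} (π : Perm (suc N)) (i : Fin N) → lookup (descentWord π) i ≡ _
  lookup-descentWord-unfolded π i = lookup∘tabulate _ i

lookup-descentWord : ∀ {N} (π : Perm (suc N)) (i : Fin N) →
  lookup (descentWord π) i ≡ descent (proj₁ π (inject₁ i)) (proj₁ π (suc i))
lookup-descentWord π@(f , _) i rewrite lookup-descentWord-unfolded π i
  with f (suc i) Fin.<? f (inject₁ i)
... | yes _ = refl
... | no  _ = refl

-- Positions past the end of a word read as 𝐚.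
letterAt : ∀ {n} → Word n → ℕ → Letter
letterAt []      _       = 𝐚
letterAt (x ∷ w) zero    = x
letterAt (x ∷ w) (suc i) = letterAt w i

lookup≡letterAt : ∀ {n} (w : Word n) (i : Fin n) → lookup w i ≡ letterAt w (toℕ i)
lookup≡letterAt (x ∷ w) zero    = refl
lookup≡letterAt (x ∷ w) (suc i) = lookup≡letterAt w i

≡-by-letterAt : ∀ {n} {w w' : Word n} →
  (∀ (i : Fin n) → letterAt w (toℕ i) ≡ letterAt w' (toℕ i)) → w ≡ w'
≡-by-letterAt {w = w} {w'} same = begin
  w                    ≡⟨ tabulate∘lookup w ⟨
  tabulate (lookup w)  ≡⟨ tabulate-cong lookup-same ⟩
  tabulate (lookup w') ≡⟨ tabulate∘lookup w' ⟩
  w'                   ∎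
  where
  open ≡-Reasoning
  lookup-same : ∀ i → lookup w i ≡ lookup w' i
  lookup-same i = trans (lookup≡letterAt w i) (trans (same i) (sym (lookup≡letterAt w' i)))

letterAt-++ˡ : ∀ {p q} (u : Word p) (v : Word q) {i} → i ℕ.< p → letterAt (u ++ v) i ≡ letterAt u i
letterAt-++ˡ (x ∷ u) v {zero}  _         = refl
letterAt-++ˡ (x ∷ u) v {suc i} (s≤s i<p) = letterAt-++ˡ u v i<p

letterAt-++-≥ : ∀ {p q} (u u' : Word p) (v : Word q) {i} → p ℕ.≤ i →
  letterAt (u ++ v) i ≡ letterAt (u' ++ v) i
letterAt-++-≥ []      []        v _                 = refl
letterAt-++-≥ (x ∷ u) (x' ∷ u') v {suc i} (s≤s p≤i) = letterAt-++-≥ u u' v p≤i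

letterAt-middle : ∀ {p q} (u : Word p) x (v : Word q) → letterAt (u ++ x ∷ v) p ≡ x
letterAt-middle []      x v = refl
letterAt-middle (y ∷ u) x v = letterAt-middle u x v

letterAt-after-middle : ∀ {p q} (u : Word p) x (v : Word q) j →
  letterAt (u ++ x ∷ v) (suc p + j) ≡ letterAt v j
letterAt-after-middle []      x v j = refl
letterAt-after-middle (y ∷ u) x v j = letterAt-after-middle u x v j

letterAt-up-to-middle : ∀ {p q q'} (u : Word p) x (v : Word q) (v' : Word q') {i} → i ℕ.≤ p →
  letterAt (u ++ x ∷ v) i ≡ letterAt (u ++ x ∷ v') i
letterAt-up-to-middle []      x v v' z≤n               = refl
letterAt-up-to-middle (y ∷ u) x v v' {zero}  _         = refl
letterAt-up-to-middle (y ∷ u) x v v' {suc i} (s≤s i≤p) = letterAt-up-to-middle u x v v' i≤p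

-- Entries a, …, a + r of a permutation in S_{N+1}; descent positions a, …, a + r − 1 lie between them.
module Window {N r : ℕ} (a : ℕ) (fits : a + r ℕ.≤ N) where

  pos : Fin (suc r) → Fin (suc N)
  pos j = fromℕ< (s≤s (ℕ.≤-trans (ℕ.+-monoʳ-≤ a (ℕ.s≤s⁻¹ (toℕ<n j))) fits))

  toℕ-pos : ∀ j → toℕ (pos j) ≡ a + toℕ j
  toℕ-pos j = toℕ-fromℕ< _

  pos-mono-< : ∀ {j k} → j Fin.< k → pos j Fin.< pos k
  pos-mono-< {j} {k} j<k = subst₂ ℕ._<_ (sym (toℕ-pos j)) (sym (toℕ-pos k)) (ℕ.+-monoʳ-< a j<k)

  pos-cancel-< : ∀ {j k} → pos j Fin.< pos k → j Fin.< k
  pos-cancel-< {j} {k} lt = ℕ.+-cancelˡ-< a _ _ (subst₂ ℕ._<_ (toℕ-pos j) (toℕ-pos k) lt)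

  pos-injective : ∀ {j k} → pos j ≡ pos k → j ≡ k
  pos-injective {j} {k} e =
    toℕ-injective (ℕ.+-cancelˡ-≡ a _ _ (trans (sym (toℕ-pos j)) (trans (cong toℕ e) (toℕ-pos k))))

  Outside : Fin (suc N) → Set
  Outside i = toℕ i ℕ.< a ⊎ a + suc r ℕ.≤ toℕ i

  pos-not-Outside : ∀ j → ¬ Outside (pos j)
  pos-not-Outside j (inj₁ lt) = ℕ.m+n≮m a (toℕ j) (subst (ℕ._< a) (toℕ-pos j) lt)
  pos-not-Outside j (inj₂ ge) = ℕ.<⇒≱ (ℕ.+-monoʳ-< a (toℕ<n j)) (subst (a + suc r ℕ.≤_) (toℕ-pos j) ge)

  left<pos : ∀ {i : Fin (suc N)} j → toℕ i ℕ.< a → i Fin.< pos j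
  left<pos j i<a = ℕ.<-≤-trans i<a (subst (a ℕ.≤_) (sym (toℕ-pos j)) (ℕ.m≤m+n a (toℕ j)))

  pos<right : ∀ {i : Fin (suc N)} j → a + suc r ℕ.≤ toℕ i → pos j Fin.< i
  pos<right j right =
    ℕ.<-≤-trans (subst (ℕ._< a + suc r) (sym (toℕ-pos j)) (ℕ.+-monoʳ-< a (toℕ<n j))) right

  inject₁-left : ∀ {I : Fin N} → toℕ I ℕ.< a → Outside (inject₁ I)
  inject₁-left {I} I<a = inj₁ (subst (ℕ._< a) (sym (toℕ-inject₁ I)) I<a)

  inject₁-right : ∀ {I : Fin N} → a + r ℕ.< toℕ I → Outside (inject₁ I)
  inject₁-right {I} a+r<I =
    inj₂ (subst₂ ℕ._≤_ (sym (ℕ.+-suc a r)) (sym (toℕ-inject₁ I)) a+r<I)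

  suc-right : ∀ {I : Fin N} → a + r ℕ.≤ toℕ I → Outside (suc I)
  suc-right {I} a+r≤I = inj₂ (subst (ℕ._≤ suc (toℕ I)) (sym (ℕ.+-suc a r)) (s≤s a+r≤I))

  classify : ∀ i → Outside i ⊎ ∃ λ j → i ≡ pos j
  classify i with toℕ i ℕ.<? a
  ... | yes i<a = inj₁ (inj₁ i<a)
  ... | no  i≮a with toℕ i ∸ a ℕ.<? suc r
  ...   | yes k<m = inj₂ (fromℕ< k<m , toℕ-injective (begin
          toℕ i                  ≡⟨ ℕ.m+[n∸m]≡n (ℕ.≮⇒≥ i≮a) ⟨
          a + (toℕ i ∸ a)        ≡⟨ cong (a +_) (toℕ-fromℕ< k<m) ⟨
          a + toℕ (fromℕ< k<m)   ≡⟨ toℕ-pos _ ⟨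
          toℕ (pos (fromℕ< k<m)) ∎))
    where open ≡-Reasoning
  ...   | no  k≮m =
          inj₁ (inj₂ (subst (a + suc r ℕ.≤_) (ℕ.m+[n∸m]≡n (ℕ.≮⇒≥ i≮a)) (ℕ.+-monoʳ-≤ a (ℕ.≮⇒≥ k≮m))))

  inner : Fin r → Fin N
  inner j = fromℕ< (ℕ.<-≤-trans (ℕ.+-monoʳ-< a (toℕ<n j)) fits)

  toℕ-inner : ∀ j → toℕ (inner j) ≡ a + toℕ j
  toℕ-inner j = toℕ-fromℕ< _

  inject₁-inner : ∀ j → inject₁ (inner j) ≡ pos (inject₁ j)
  inject₁-inner j = toℕ-injective (begin
    toℕ (inject₁ (inner j)) ≡⟨ toℕ-inject₁ (inner j) ⟩
    toℕ (inner j)           ≡⟨ toℕ-inner j ⟩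
    a + toℕ j               ≡⟨ cong (a +_) (toℕ-inject₁ j) ⟨
    a + toℕ (inject₁ j)     ≡⟨ toℕ-pos (inject₁ j) ⟨
    toℕ (pos (inject₁ j))   ∎)
    where open ≡-Reasoning

  suc-inner : ∀ j → suc (inner j) ≡ pos (suc j)
  suc-inner j = toℕ-injective (begin
    suc (toℕ (inner j)) ≡⟨ cong suc (toℕ-inner j) ⟩
    suc (a + toℕ j)     ≡⟨ ℕ.+-suc a (toℕ j) ⟨
    a + suc (toℕ j)     ≡⟨ toℕ-pos (suc j) ⟨
    toℕ (pos (suc j))   ∎)
    where open ≡-Reasoning

  data Region (I : Fin N) : Set where
    before    : suc (toℕ I) ℕ.< a → Region I
    leftEdge  : suc (toℕ I) ≡ a → Region I
    inside    : ∀ j → I ≡ inner j → Region I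
    rightEdge : toℕ I ≡ a + r → Region I
    after     : a + r ℕ.< toℕ I → Region I

  region : ∀ I → Region I
  region I with ℕ.<-cmp (suc (toℕ I)) a
  ... | tri< I+1<a _ _ = before I+1<a
  ... | tri≈ _ I+1≡a _ = leftEdge I+1≡a
  ... | tri> _ _ a<I+1 with toℕ I ∸ a ℕ.<? r | ℕ.m+[n∸m]≡n (ℕ.s≤s⁻¹ a<I+1)
  ...   | yes k<r | a+k≡I = inside (fromℕ< k<r) (toℕ-injective (begin
          toℕ I                  ≡⟨ a+k≡I ⟨
          a + (toℕ I ∸ a)        ≡⟨ cong (a +_) (toℕ-fromℕ< k<r) ⟨
          a + toℕ (fromℕ< k<r)   ≡⟨ toℕ-inner _ ⟨
          toℕ (inner (fromℕ< k<r)) ∎))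
    where open ≡-Reasoning
  ...   | no  k≮r | a+k≡I with toℕ I ∸ a ℕ.≟ r
  ...     | yes k≡r = rightEdge (trans (sym a+k≡I) (cong (a +_) k≡r))
  ...     | no  k≢r =
            after (subst (a + r ℕ.<_) a+k≡I (ℕ.+-monoʳ-< a (ℕ.≤∧≢⇒< (ℕ.≮⇒≥ k≮r) (k≢r ∘ sym))))

  module Pattern (π : Perm (suc N)) where

    f : Fin (suc N) → Fin (suc N)
    f = proj₁ π

    open Standardisation (λ j → toℕ (f (pos j))) (λ j k e → pos-injective (proj₂ π _ _ (toℕ-injective e)))
      using ()
      renaming (standardise to α; standardise-mono-< to α-mono-<; standardise-cancel-< to α-cancel-<)
      public

    lookup-descentWord-α : ∀ j → lookup (descentWord α) j ≡ lookup (descentWord π) (inner j)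
    lookup-descentWord-α j = begin
      lookup (descentWord α) j                            ≡⟨ lookup-descentWord α j ⟩
      descent (proj₁ α (inject₁ j)) (proj₁ α (suc j))     ≡⟨ descent-cong α-cancel-< α-mono-< ⟩
      descent (f (pos (inject₁ j))) (f (pos (suc j)))     ≡⟨ cong₂ (λ x y → descent (f x) (f y))
                                                                   (inject₁-inner j) (suc-inner j) ⟨
      descent (f (inject₁ (inner j))) (f (suc (inner j))) ≡⟨ lookup-descentWord π (inner j) ⟨
      lookup (descentWord π) (inner j)                    ∎
      where open ≡-Reasoning

    α⁻¹ : Fin (suc r) → Fin (suc r)
    α⁻¹ k = proj₁ (Perm-surjective α k)

    α∘α⁻¹ : ∀ k → proj₁ α (α⁻¹ k) ≡ k
    α∘α⁻¹ k = proj₂ (Perm-surjective α k)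

    sorted : Fin (suc r) → Fin (suc N)
    sorted k = f (pos (α⁻¹ k))

    sorted-α : ∀ j → sorted (proj₁ α j) ≡ f (pos j)
    sorted-α j = cong (f ∘ pos) (proj₂ α _ _ (α∘α⁻¹ (proj₁ α j)))

    sorted-increasing : StrictlyIncreasing sorted
    sorted-increasing {k} {l} k<l = α-cancel-< (subst₂ Fin._<_ (sym (α∘α⁻¹ k)) (sym (α∘α⁻¹ l)) k<l)

    module _ (β : Perm (suc r)) where

      private
        b : Fin (suc r) → Fin (suc r)
        b = proj₁ β

      valueAt : ∀ i → Outside i ⊎ ∃ (λ j → i ≡ pos j) → Fin (suc N)
      valueAt i (inj₁ _)       = f i
      valueAt i (inj₂ (j , _)) = sorted (b j)

      valueAt-outside : ∀ {i} → Outside i → ∀ c → valueAt i c ≡ f i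
      valueAt-outside out (inj₁ _)          = refl
      valueAt-outside out (inj₂ (j , refl)) = contradiction out (pos-not-Outside j)

      valueAt-pos : ∀ j c → valueAt (pos j) c ≡ sorted (b j)
      valueAt-pos j (inj₁ out)     = contradiction out (pos-not-Outside j)
      valueAt-pos j (inj₂ (k , e)) = cong (sorted ∘ b) (pos-injective (sym e))

      valueAt-injective : ∀ i i' c c' → valueAt i c ≡ valueAt i' c' → i ≡ i'
      valueAt-injective i i' (inj₁ _) (inj₁ _) e = proj₂ π i i' e
      valueAt-injective i _ (inj₁ out) (inj₂ (j , refl)) e =
        contradiction (subst Outside (proj₂ π _ _ e) out) (pos-not-Outside _)
      valueAt-injective _ i' (inj₂ (j , refl)) (inj₁ out) e =
        contradiction (subst Outside (proj₂ π _ _ (sym e)) out) (pos-not-Outside _)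
      valueAt-injective _ _ (inj₂ (j , refl)) (inj₂ (j' , refl)) e =
        cong pos (proj₂ β _ _ (increasing-injective sorted-increasing e))

      replace : Perm (suc N)
      replace = (λ i → valueAt i (classify i)) , λ i i' → valueAt-injective i i' (classify i) (classify i')

      replace-outside : ∀ {i} → Outside i → proj₁ replace i ≡ f i
      replace-outside {i} out = valueAt-outside out (classify i)

      replace-pos : ∀ j → proj₁ replace (pos j) ≡ sorted (b j)
      replace-pos j = valueAt-pos j (classify (pos j))

      private
        ρ : Fin (suc N) → Fin (suc N)
        ρ = proj₁ replace

      lookup-descentWord-replace-inner : ∀ j →
        lookup (descentWord replace) (inner j) ≡ lookup (descentWord β) j
      lookup-descentWord-replace-inner j = begin
        lookup (descentWord replace) (inner j)              ≡⟨ lookup-descentWord replace (inner j) ⟩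
        descent (ρ (inject₁ (inner j))) (ρ (suc (inner j))) ≡⟨ cong₂ (λ x y → descent (ρ x) (ρ y))
                                                                     (inject₁-inner j) (suc-inner j) ⟩
        descent (ρ (pos (inject₁ j))) (ρ (pos (suc j)))     ≡⟨ cong₂ descent (replace-pos (inject₁ j))
                                                                             (replace-pos (suc j)) ⟩
        descent (sorted (b (inject₁ j))) (sorted (b (suc j)))
          ≡⟨ descent-cong (increasing-cancel-< sorted-increasing) sorted-increasing ⟩
        descent (b (inject₁ j)) (b (suc j))                 ≡⟨ lookup-descentWord β j ⟨
        lookup (descentWord β) j                            ∎
        where open ≡-Reasoning

      lookup-descentWord-replace-outside : ∀ I → Outside (inject₁ I) → Outside (suc I) →
        lookup (descentWord replace) I ≡ lookup (descentWord π) I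
      lookup-descentWord-replace-outside I out out' = begin
        lookup (descentWord replace) I   ≡⟨ lookup-descentWord replace I ⟩
        descent (ρ (inject₁ I)) (ρ (suc I)) ≡⟨ cong₂ descent (replace-outside out) (replace-outside out') ⟩
        descent (f (inject₁ I)) (f (suc I)) ≡⟨ lookup-descentWord π I ⟨
        lookup (descentWord π) I         ∎
        where open ≡-Reasoning

      -- An ascent into the window survives because α ≤w β can only raise its first entry.
      lookup-descentWord-replace-leftEdge : α ≤w β → ∀ I → suc (toℕ I) ≡ a →
        lookup (descentWord π) I ≡ 𝐚 → lookup (descentWord replace) I ≡ 𝐚
      lookup-descentWord-replace-leftEdge α≤β I I+1≡a ascent = begin
        lookup (descentWord replace) I            ≡⟨ lookup-descentWord replace I ⟩
        descent (ρ (inject₁ I)) (ρ (suc I))       ≡⟨ cong₂ descent (replace-outside out)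
                                                       (trans (cong ρ I+1≡pos₀) (replace-pos zero)) ⟩
        descent (f (inject₁ I)) (sorted (b zero)) ≡⟨ descent≡𝐚 (λ lt → old (ℕ.≤-<-trans f-pos₀≤ lt)) ⟩
        𝐚                                         ∎
        where
        open ≡-Reasoning
        out : Outside (inject₁ I)
        out = inject₁-left (subst (toℕ I ℕ.<_) I+1≡a (ℕ.n<1+n _))
        I+1≡pos₀ : suc I ≡ pos zero
        I+1≡pos₀ = toℕ-injective (trans I+1≡a (trans (sym (ℕ.+-identityʳ a)) (sym (toℕ-pos zero))))
        old : ¬ f (pos zero) Fin.< f (inject₁ I)
        old = subst (λ k → ¬ f k Fin.< f (inject₁ I)) I+1≡pos₀
          (descent≡𝐚⁻¹ (trans (sym (lookup-descentWord π I)) ascent))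
        f-pos₀≤ : f (pos zero) Fin.≤ sorted (b zero)
        f-pos₀≤ = subst (Fin._≤ sorted (b zero)) (sorted-α zero)
          (increasing-mono-≤ {t = sorted} sorted-increasing (≤w-head α β α≤β))

      lookup-descentWord-replace-rightEdge : α ≤w β → ∀ I → toℕ I ≡ a + r →
        lookup (descentWord π) I ≡ 𝐚 → lookup (descentWord replace) I ≡ 𝐚
      lookup-descentWord-replace-rightEdge α≤β I I≡a+r ascent = begin
        lookup (descentWord replace) I      ≡⟨ lookup-descentWord replace I ⟩
        descent (ρ (inject₁ I)) (ρ (suc I)) ≡⟨ cong₂ descent (trans (cong ρ I≡posₗ) (replace-pos ℓ))
                                                             (replace-outside out) ⟩
        descent (sorted (b ℓ)) (f (suc I))  ≡⟨ descent≡𝐚 (λ lt → old (ℕ.<-≤-trans lt ≤f-posₗ)) ⟩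
        𝐚                                   ∎
        where
        open ≡-Reasoning
        ℓ : Fin (suc r)
        ℓ = Fin.fromℕ r
        out : Outside (suc I)
        out = suc-right (ℕ.≤-reflexive (sym I≡a+r))
        I≡posₗ : inject₁ I ≡ pos ℓ
        I≡posₗ = toℕ-injective (begin
          toℕ (inject₁ I) ≡⟨ toℕ-inject₁ I ⟩
          toℕ I           ≡⟨ I≡a+r ⟩
          a + r           ≡⟨ cong (a +_) (toℕ-fromℕ r) ⟨
          a + toℕ ℓ       ≡⟨ toℕ-pos ℓ ⟨
          toℕ (pos ℓ)     ∎)
        old : ¬ f (suc I) Fin.< f (pos ℓ)
        old = subst (λ k → ¬ f (suc I) Fin.< f k) I≡posₗ
          (descent≡𝐚⁻¹ (trans (sym (lookup-descentWord π I)) ascent))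
        ≤f-posₗ : sorted (b ℓ) Fin.≤ f (pos ℓ)
        ≤f-posₗ = subst (sorted (b ℓ) Fin.≤_) (sorted-α ℓ)
          (increasing-mono-≤ {t = sorted} sorted-increasing (≤w-last α β α≤β))

      replace-hits : ∀ j → ∃ λ j' → ρ (pos j') ≡ f (pos j)
      replace-hits j with Perm-surjective β (proj₁ α j)
      ... | j' , bj'≡αj = j' , trans (replace-pos j') (trans (cong sorted bj'≡αj) (sorted-α j))

      ≤w-replace : α ≤w β → π ≤w replace
      ≤w-replace α≤β _ _ (i , j , i<j , refl , refl , fj<fi) = inversion (classify i) (classify j)
        where
        inversion : Outside i ⊎ ∃ (λ k → i ≡ pos k) → Outside j ⊎ ∃ (λ l → j ≡ pos l) →
          (f i , f j) ∈Inv replace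
        inversion (inj₁ out) (inj₁ out') =
          i , j , i<j , replace-outside out , replace-outside out' , fj<fi
        inversion (inj₂ (k , refl)) (inj₂ (l , refl)) =
          windowInversion (α≤β _ _ (k , l , pos-cancel-< i<j , refl , refl , α-mono-< fj<fi))
          where
          windowInversion : (proj₁ α k , proj₁ α l) ∈Inv β → (f (pos k) , f (pos l)) ∈Inv replace
          windowInversion (k' , l' , k'<l' , bk'≡αk , bl'≡αl , _) =
            pos k' , pos l' , pos-mono-< k'<l' ,
            trans (replace-pos k') (trans (cong sorted bk'≡αk) (sorted-α k)) ,
            trans (replace-pos l') (trans (cong sorted bl'≡αl) (sorted-α l)) , fj<fi
        inversion (inj₁ (inj₁ i<a)) (inj₂ (l , refl)) =
          i , l' , left<pos _ i<a , replace-outside (inj₁ i<a) , proj₂ (replace-hits l) , fj<fi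
          where
          l' : Fin (suc N)
          l' = pos (proj₁ (replace-hits l))
        inversion (inj₂ (k , refl)) (inj₁ (inj₂ right)) =
          k' , j , pos<right _ right , proj₂ (replace-hits k) , replace-outside (inj₂ right) , fj<fi
          where
          k' : Fin (suc N)
          k' = pos (proj₁ (replace-hits k))
        inversion (inj₁ (inj₂ right)) (inj₂ (l , refl)) = contradiction i<j (ℕ.<-asym (pos<right l right))
        inversion (inj₂ (k , refl)) (inj₁ (inj₁ j<a))   = contradiction i<j (ℕ.<-asym (left<pos k j<a))

  module _ {π₁ π₂ : Perm (suc N)} {β₁ β₂ : Perm (suc r)} where
    private
      module P₁ = Pattern π₁
      module P₂ = Pattern π₂
      b₁ b₂ : Fin (suc r) → Fin (suc r)
      b₁ = proj₁ β₁
      b₂ = proj₁ β₂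

    -- Both sorted lists are increasing, so b₂ ∘ b₁⁻¹ is an increasing permutation, i.e. the identity.
    replace-injective : P₁.replace β₁ ≈P P₂.replace β₂ → β₁ ≈P β₂ × (∀ k → P₁.sorted k ≡ P₂.sorted k)
    replace-injective same = b₁≗b₂ , sorted₁≗sorted₂
      where
      b₁⁻¹ : Fin (suc r) → Fin (suc r)
      b₁⁻¹ k = proj₁ (Perm-surjective β₁ k)
      b₁∘b₁⁻¹ : ∀ k → b₁ (b₁⁻¹ k) ≡ k
      b₁∘b₁⁻¹ k = proj₂ (Perm-surjective β₁ k)
      sorted-b : ∀ j → P₁.sorted (b₁ j) ≡ P₂.sorted (b₂ j)
      sorted-b j = trans (sym (P₁.replace-pos β₁ j)) (trans (same (pos j)) (P₂.replace-pos β₂ j))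
      τ : Fin (suc r) → Fin (suc r)
      τ k = b₂ (b₁⁻¹ k)
      sorted₂∘τ : ∀ k → P₂.sorted (τ k) ≡ P₁.sorted k
      sorted₂∘τ k = trans (sym (sorted-b (b₁⁻¹ k))) (cong P₁.sorted (b₁∘b₁⁻¹ k))
      τ-increasing : StrictlyIncreasing τ
      τ-increasing {k} {l} k<l = increasing-cancel-< {t = P₂.sorted} P₂.sorted-increasing
        (subst₂ Fin._<_ (sym (sorted₂∘τ k)) (sym (sorted₂∘τ l)) (P₁.sorted-increasing k<l))
      sorted₁≗sorted₂ : ∀ k → P₁.sorted k ≡ P₂.sorted k
      sorted₁≗sorted₂ k = trans (sym (sorted₂∘τ k)) (cong P₂.sorted (increasing⇒≗id τ τ-increasing k))
      b₁≗b₂ : ∀ j → b₁ j ≡ b₂ j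
      b₁≗b₂ j = begin
        b₁ j             ≡⟨ increasing⇒≗id τ τ-increasing (b₁ j) ⟨
        b₂ (b₁⁻¹ (b₁ j)) ≡⟨ cong b₂ (proj₂ β₁ _ _ (b₁∘b₁⁻¹ (b₁ j))) ⟩
        b₂ j             ∎
        where open ≡-Reasoning

    replace-cancel : P₁.replace β₁ ≈P P₂.replace β₂ → P₁.α ≈P P₂.α → π₁ ≈P π₂
    replace-cancel same α₁≈α₂ i with classify i
    ... | inj₁ out        =
      trans (sym (P₁.replace-outside β₁ out)) (trans (same i) (P₂.replace-outside β₂ out))
    ... | inj₂ (j , refl) = begin
      P₁.f (pos j)             ≡⟨ P₁.sorted-α j ⟨
      P₁.sorted (proj₁ P₁.α j) ≡⟨ proj₂ (replace-injective same) _ ⟩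
      P₂.sorted (proj₁ P₁.α j) ≡⟨ cong P₂.sorted (α₁≈α₂ j) ⟩
      P₂.sorted (proj₁ P₂.α j) ≡⟨ P₂.sorted-α j ⟩
      P₂.f (pos j)             ∎
      where open ≡-Reasoning

window-dominates : ∀ {N r} (a : ℕ) {S T : Word r} {W W' : Word N} → a + r ℕ.≤ N →
  (∀ i → i ℕ.< N → i ℕ.< a ⊎ a + r ℕ.≤ i → letterAt W i ≡ letterAt W' i) →
  (∀ i → suc i ≡ a → letterAt W i ≡ 𝐚) →
  (a + r ℕ.< N → letterAt W (a + r) ≡ 𝐚) →
  (∀ j → j ℕ.< r → letterAt W (a + j) ≡ letterAt T j) →
  (∀ j → j ℕ.< r → letterAt W' (a + j) ≡ letterAt S j) →
  Dominates S T → Dominates W' W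
window-dominates {N} {r} a {S} {T} {W} {W'} fits agree ascent-before ascent-after W-window W'-window
  (φ , φ-injective , φ-≤w) = φ' , φ'-injective , λ π → Pattern.≤w-replace (proj₁ π) (σ π) (α≤σ π)
  where
  open Window a fits

  letterAt-W : (π : D W) → ∀ I → lookup (descentWord (proj₁ π)) I ≡ letterAt W (toℕ I)
  letterAt-W (π , dπ≡W) I = trans (cong (λ w → lookup w I) dπ≡W) (lookup≡letterAt W I)

  α-in-D : D W → D T
  α-in-D π = α , ≡-by-letterAt λ j → begin
    letterAt (descentWord α) (toℕ j)         ≡⟨ lookup≡letterAt (descentWord α) j ⟨
    lookup (descentWord α) j                 ≡⟨ Pattern.lookup-descentWord-α (proj₁ π) j ⟩
    lookup (descentWord (proj₁ π)) (inner j) ≡⟨ letterAt-W π (inner j) ⟩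
    letterAt W (toℕ (inner j))               ≡⟨ cong (letterAt W) (toℕ-inner j) ⟩
    letterAt W (a + toℕ j)                   ≡⟨ W-window (toℕ j) (toℕ<n j) ⟩
    letterAt T (toℕ j)                       ∎
    where
    open ≡-Reasoning
    α : Perm (suc r)
    α = Pattern.α (proj₁ π)

  σ : D W → Perm (suc r)
  σ π = proj₁ (φ (α-in-D π))

  α≤σ : ∀ π → Pattern.α (proj₁ π) ≤w σ π
  α≤σ π = φ-≤w (α-in-D π)

  image : D W → Perm (suc N)
  image π = Pattern.replace (proj₁ π) (σ π)

  unchanged : ∀ π I → Outside (inject₁ I) → Outside (suc I) →
    lookup (descentWord (image π)) I ≡ letterAt W (toℕ I)
  unchanged π I out out' =
    trans (Pattern.lookup-descentWord-replace-outside (proj₁ π) (σ π) I out out') (letterAt-W π I)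

  W≡W'-outside : ∀ I → toℕ I ℕ.< a ⊎ a + r ℕ.≤ toℕ I → letterAt W (toℕ I) ≡ letterAt W' (toℕ I)
  W≡W'-outside I = agree (toℕ I) (toℕ<n I)

  letterAt-image : ∀ π I → Region I → lookup (descentWord (image π)) I ≡ letterAt W' (toℕ I)
  letterAt-image π I (before I+1<a) =
    trans (unchanged π I (inject₁-left I<a) (inj₁ I+1<a)) (W≡W'-outside I (inj₁ I<a))
    where
    I<a : toℕ I ℕ.< a
    I<a = ℕ.<-trans (ℕ.n<1+n _) I+1<a
  letterAt-image π I (after a+r<I) =
    trans (unchanged π I (inject₁-right a+r<I) (suc-right (ℕ.<⇒≤ a+r<I)))
          (W≡W'-outside I (inj₂ (ℕ.<⇒≤ a+r<I)))
  letterAt-image π I (leftEdge I+1≡a) = begin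
    lookup (descentWord (image π)) I ≡⟨ Pattern.lookup-descentWord-replace-leftEdge (proj₁ π) (σ π)
                                          (α≤σ π) I I+1≡a (trans (letterAt-W π I) W-𝐚) ⟩
    𝐚                                ≡⟨ W-𝐚 ⟨
    letterAt W (toℕ I)               ≡⟨ W≡W'-outside I (inj₁ (subst (toℕ I ℕ.<_) I+1≡a (ℕ.n<1+n _))) ⟩
    letterAt W' (toℕ I)              ∎
    where
    open ≡-Reasoning
    W-𝐚 : letterAt W (toℕ I) ≡ 𝐚
    W-𝐚 = ascent-before (toℕ I) I+1≡a
  letterAt-image π I (rightEdge I≡a+r) = begin
    lookup (descentWord (image π)) I ≡⟨ Pattern.lookup-descentWord-replace-rightEdge (proj₁ π) (σ π)
                                          (α≤σ π) I I≡a+r (trans (letterAt-W π I) W-𝐚) ⟩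
    𝐚                                ≡⟨ W-𝐚 ⟨
    letterAt W (toℕ I)               ≡⟨ W≡W'-outside I (inj₂ (ℕ.≤-reflexive (sym I≡a+r))) ⟩
    letterAt W' (toℕ I)              ∎
    where
    open ≡-Reasoning
    W-𝐚 : letterAt W (toℕ I) ≡ 𝐚
    W-𝐚 = subst (λ k → letterAt W k ≡ 𝐚) (sym I≡a+r) (ascent-after (subst (ℕ._< N) I≡a+r (toℕ<n I)))
  letterAt-image π _ (inside j refl) = begin
    lookup (descentWord (image π)) (inner j) ≡⟨ Pattern.lookup-descentWord-replace-inner (proj₁ π) (σ π) j ⟩
    lookup (descentWord (σ π)) j             ≡⟨ cong (λ w → lookup w j) (proj₂ (φ (α-in-D π))) ⟩
    lookup S j                               ≡⟨ lookup≡letterAt S j ⟩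
    letterAt S (toℕ j)                       ≡⟨ W'-window (toℕ j) (toℕ<n j) ⟨
    letterAt W' (a + toℕ j)                  ≡⟨ cong (letterAt W') (toℕ-inner j) ⟨
    letterAt W' (toℕ (inner j))              ∎
    where open ≡-Reasoning

  φ' : D W → D W'
  φ' π = image π , ≡-by-letterAt λ I →
    trans (sym (lookup≡letterAt (descentWord (image π)) I)) (letterAt-image π I (region I))

  φ'-injective : ∀ π₁ π₂ → proj₁ (φ' π₁) ≈P proj₁ (φ' π₂) → proj₁ π₁ ≈P proj₁ π₂
  φ'-injective π₁ π₂ same = replace-cancel {β₁ = σ π₁} {σ π₂} same
    (φ-injective (α-in-D π₁) (α-in-D π₂) (proj₁ (replace-injective {proj₁ π₁} {proj₁ π₂} same)))

dominates-++ʳ : ∀ {r q} {S T : Word r} (v : Word q) → Dominates S T → Dominates (S ++ 𝐚 ∷ v) (T ++ 𝐚 ∷ v)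
dominates-++ʳ {r} {q} {S} {T} v = window-dominates 0 (ℕ.m≤m+n r (suc q))
  (λ { i _ (inj₂ r≤i) → letterAt-++-≥ T S (𝐚 ∷ v) r≤i })
  (λ _ ())
  (λ _ → letterAt-middle T 𝐚 v)
  (λ j j<r → letterAt-++ˡ T (𝐚 ∷ v) j<r)
  (λ j j<r → letterAt-++ˡ S (𝐚 ∷ v) j<r)

dominates-++ˡ : ∀ {p r} {S T : Word r} (u : Word p) → Dominates S T → Dominates (u ++ 𝐚 ∷ S) (u ++ 𝐚 ∷ T)
dominates-++ˡ {p} {r} {S} {T} u = window-dominates (suc p) (ℕ.≤-reflexive p+1+r≡N)
  agree
  (λ { i refl → letterAt-middle u 𝐚 T })
  (λ p+1+r<N → contradiction p+1+r<N (ℕ.<-irrefl p+1+r≡N))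
  (λ j _ → letterAt-after-middle u 𝐚 T j)
  (λ j _ → letterAt-after-middle u 𝐚 S j)
  where
  p+1+r≡N : suc p + r ≡ p + suc r
  p+1+r≡N = sym (ℕ.+-suc p r)
  agree : ∀ i → i ℕ.< p + suc r → i ℕ.< suc p ⊎ suc p + r ℕ.≤ i →
    letterAt (u ++ 𝐚 ∷ T) i ≡ letterAt (u ++ 𝐚 ∷ S) i
  agree i _   (inj₁ i<p+1) = letterAt-up-to-middle u 𝐚 T S (ℕ.s≤s⁻¹ i<p+1)
  agree i i<N (inj₂ N≤i)   = contradiction (subst (ℕ._≤ i) p+1+r≡N N≤i) (ℕ.<⇒≱ i<N)

proposition5p3 : (r : ℕ) (S T : Word r) → Dominates S T →
    (p q : ℕ) (u : Word p) (v : Word q) →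
      Dominates (S ++ (𝐚 ∷ v)) (T ++ (𝐚 ∷ v))
      × Dominates (u ++ (𝐚 ∷ S)) (u ++ (𝐚 ∷ T))
      × Dominates (u ++ (𝐚 ∷ (S ++ (𝐚 ∷ v)))) (u ++ (𝐚 ∷ (T ++ (𝐚 ∷ v))))
proposition5p3 r S T S≽T p q u v = S𝐚v≽T𝐚v , dominates-++ˡ u S≽T , dominates-++ˡ u S𝐚v≽T𝐚v
  where
  S𝐚v≽T𝐚v : Dominates (S ++ 𝐚 ∷ v) (T ++ 𝐚 ∷ v)
  S𝐚v≽T𝐚v = dominates-++ʳ v S≽T
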